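{- Let $G$ be a finite simple graph of order $n \ge 2$ and let $v \in V(G)$. Then $$\gamma(M(G\setminus v)) \le \gamma(M(G)) \le \gamma(M(G\setminus v)) + 1.$$
   Context: $G\setminus v$ denotes the subgraph of $G$ induced on $V(G)\setminus\{v\}$. For a finite simple graph $H$, the middle graph $M(H)$ is the graph with vertex set $V(H)\cup E(H)$ in which two elements $x,y$ are adjacent if and only if either (1) $x,y\in E(H)$ and the edges $x,y$ share a common endpoint in $H$, or (2) $x\in V(H)$, $y\in E(H)$ and $x$ is an endpoint of $y$ (or vice versa). A dominating set of a graph $H$ is a set $S\subseteq V(H)$ such that every vertex of $H$ is in $S$ or adjacent to a vertex of $S$; the domination number $\gamma(H)$ is the minimum cardinality of a dominating set of $H$. -}

module Defs where

open import Data.Nat using (ℕ; suc; _≤_)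
open import Data.Fin using (Fin; _<_; punchIn)
open import Data.Bool using (Bool; true; false)
open import Data.Product using (Σ; ∃; _×_; _,_; proj₁; proj₂)
open import Data.Sum using (_⊎_; inj₁; inj₂)
open import Data.List using (List; length)
open import Data.List.Membership.Propositional using (_∈_)
open import Relation.Binary.PropositionalEquality using (_≡_; _≢_)

record SimpleGraph (n : ℕ) : Set where
  field
    adj    : Fin n → Fin n → Bool
    sym    : ∀ i j → adj i j ≡ adj j i
    irrefl : ∀ i → adj i i ≡ false
open SimpleGraph public

deleteVertex : ∀ {m} → SimpleGraph (suc m) → Fin (suc m) → SimpleGraph m
deleteVertex G v = record
  { adj    = λ i j → adj G (punchIn v i) (punchIn v j)
  ; sym    = λ i j → sym G (punchIn v i) (punchIn v j)
  ; irrefl = λ i → irrefl G (punchIn v i) }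

-- An edge {i , j} of H, represented uniquely with i < j.
Edge : ∀ {n} → SimpleGraph n → Set
Edge {n} H = Σ (Fin n) λ i → Σ (Fin n) λ j → (i < j) × (adj H i j ≡ true)

fst : ∀ {n} {H : SimpleGraph n} → Edge H → Fin n
fst e = proj₁ e

snd : ∀ {n} {H : SimpleGraph n} → Edge H → Fin n
snd e = proj₁ (proj₂ e)

Endpoint : ∀ {n} {H : SimpleGraph n} → Fin n → Edge H → Set
Endpoint {H = H} x e = (x ≡ fst {H = H} e) ⊎ (x ≡ snd {H = H} e)

record Graph (V : Set) : Set₁ where
  field
    Adj : V → V → Set

middleAdj : ∀ {n} (H : SimpleGraph n) → (Fin n ⊎ Edge H) → (Fin n ⊎ Edge H) → Set
middleAdj H (inj₁ x) (inj₁ y) = Data.Empty.⊥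
  where import Data.Empty
middleAdj H (inj₁ x) (inj₂ e) = Endpoint {H = H} x e
middleAdj H (inj₂ e) (inj₁ x) = Endpoint {H = H} x e
middleAdj {n} H (inj₂ e) (inj₂ f) =
  ((fst {H = H} e , snd {H = H} e) ≢ (fst {H = H} f , snd {H = H} f))
  × (Σ (Fin n) λ x → Endpoint {H = H} x e × Endpoint {H = H} x f)

Middle : ∀ {n} (H : SimpleGraph n) → Graph (Fin n ⊎ Edge H)
Middle H = record { Adj = middleAdj H }

Dominating : ∀ {V} → Graph V → List V → Set
Dominating {V} G S = ∀ (x : V) → (x ∈ S) ⊎ (Σ V λ y → (y ∈ S) × Graph.Adj G y x)

IsDominationNumber : ∀ {V} → Graph V → ℕ → Set
IsDominationNumber G k =
  (Σ _ λ S → Dominating G S × (length S ≡ k))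
  × (∀ S → Dominating G S → k ≤ length S)

module Submission where

open import Defs
open import Data.Nat using (ℕ; suc; _+_; _≤_)
open import Data.Fin using (Fin)
open import Data.Product using (_×_)

open import Data.Nat using (s≤s)
open import Data.Nat.Properties using (≤-trans; ≤-reflexive; +-comm; <⇒≤)
open import Data.Fin using (punchIn; punchOut) renaming (_<_ to _<ᶠ_)
open import Data.Fin.Properties
  using (_≟_; <-irrelevant; punchIn-injective; punchInᵢ≢i; punchIn-mono-≤; punchIn-punchOut;
         punchOut-mono-≤; punchOut-injective; ≤∧≢⇒<; <⇒≢)
open import Data.Bool using (true)
import Data.Bool.Properties as Bool
open import Data.Product using (Σ; _,_; proj₁; proj₂)
open import Data.Sum using (_⊎_; inj₁; inj₂)
open import Data.Sum.Properties using (inj₁-injective; inj₂-injective)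
open import Data.Maybe using (Maybe; just; nothing)
import Data.Maybe.Relation.Unary.Any as MaybeAny
open import Data.List using (List; _∷_; length; map; mapMaybe)
open import Data.List.Properties using (length-map; length-mapMaybe)
open import Data.List.Relation.Unary.Any using (here; there)
import Data.List.Relation.Unary.Any as Any
import Data.List.Relation.Unary.Any.Properties as Any
open import Data.List.Membership.Propositional using (_∈_)
open import Data.List.Membership.Propositional.Properties using (∈-map⁺)
open import Data.Empty using (⊥-elim)
open import Relation.Nullary using (yes; no; ¬_)
open import Relation.Binary.PropositionalEquality
  using (_≡_; refl; trans; cong; cong₂; subst; subst₂) renaming (sym to ≡-sym)
open import Axiom.UniquenessOfIdentityProofs using (module Decidable⇒UIP)

-- Write H = G ∖ v.  The middle graph M(H) embeds into M(G) via
-- ι (vertices and edges of H are vertices and edges of G), and ι preserves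
-- and reflects adjacency.  Every element of M(G) outside the image of ι is v
-- itself or an edge at v, so all of them are dominated by v.
--
--  * Upper bound: if S dominates M(H), then v together with ι(S) dominates
--    M(G); hence γ(M(G)) ≤ γ(M(H)) + 1.
--  * Lower bound: project M(G) back onto M(H) by a partial map that deletes
--    v, sends an edge vw to the vertex w and inverts ι elsewhere.  Whenever d
--    dominates ι(y) in M(G), the projection of d is defined and dominates y
--    in M(H); so the projection maps a dominating set of M(G) to one of M(H)
--    that is no larger, and γ(M(H)) ≤ γ(M(G)).

Dominates : ∀ {V} → Graph V → V → V → Set
Dominates A d x = (d ≡ x) ⊎ Graph.Adj A d x

dominator : ∀ {V} {A : Graph V} {S : List V} → Dominating A S
          → ∀ x → Σ V λ d → (d ∈ S) × Dominates A d x
dominator domS x with domS x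
... | inj₁ x∈S            = x , x∈S , inj₁ refl
... | inj₂ (d , d∈S , dx) = d , d∈S , inj₂ dx

dominated : ∀ {V} {A : Graph V} {S : List V} {d x : V}
          → d ∈ S → Dominates A d x → (x ∈ S) ⊎ (Σ V λ y → (y ∈ S) × Graph.Adj A y x)
dominated d∈S (inj₁ refl) = inj₁ d∈S
dominated d∈S (inj₂ dx)   = inj₂ (_ , d∈S , dx)

∈-mapMaybe⁺ : ∀ {A B : Set} (g : A → Maybe B) {x : A} {y : B} {xs : List A}
            → x ∈ xs → g x ≡ just y → y ∈ mapMaybe g xs
∈-mapMaybe⁺ g {xs = xs} x∈xs gx≡y =
  Any.mapMaybe⁺ g xs (Any.map⁺ (Any.map (λ { refl → subst (MaybeAny.Any (_ ≡_)) (≡-sym gx≡y) (MaybeAny.just refl) }) x∈xs))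

dominating-project : ∀ {V W} (A : Graph V) (B : Graph W) (ι : W → V) (g : V → Maybe W)
  → (∀ d w → Dominates A d (ι w) → Σ W λ z → (g d ≡ just z) × Dominates B z w)
  → ∀ S → Dominating A S → Dominating B (mapMaybe g S)
dominating-project A B ι g project S domS w with dominator domS (ι w)
... | d , d∈S , dw with project d w dw
...   | z , gd≡z , zw = dominated {A = B} (∈-mapMaybe⁺ g d∈S gd≡z) zw

dominating-cone : ∀ {V W} (A : Graph V) (B : Graph W) (ι : W → V) (c : V)
  → (∀ y z → Graph.Adj B y z → Graph.Adj A (ι y) (ι z))
  → (∀ x → (Σ W λ w → ι w ≡ x) ⊎ Dominates A c x)
  → ∀ S → Dominating B S → Dominating A (c ∷ map ι S)
dominating-cone A B ι c hom cover S domS x with cover x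
... | inj₂ cx = dominated {A = A} (here refl) cx
... | inj₁ (w , refl) with dominator domS w
...   | y , y∈S , inj₁ refl = inj₁ (there (∈-map⁺ ι y∈S))
...   | y , y∈S , inj₂ yw   = inj₂ (ι y , there (∈-map⁺ ι y∈S) , hom y w yw)

domination-number-≤ : ∀ {V W} {A : Graph V} {B : Graph W} {a b : ℕ} (k : ℕ)
  → IsDominationNumber A a → IsDominationNumber B b
  → (∀ S → Dominating A S → Σ (List W) λ T → Dominating B T × (length T ≤ k + length S))
  → b ≤ k + a
domination-number-≤ k ((S , domS , refl) , _) (_ , minB) transfer
  with transfer S domS
... | T , domT , T≤S = ≤-trans (minB T domT) T≤S

-- An edge is determined by its endpoints: the order and adjacency proofs
-- carried by an edge are unique.
edge-≡ : ∀ {n} {K : SimpleGraph n} (e f : Edge K)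
       → fst {H = K} e ≡ fst {H = K} f → snd {H = K} e ≡ snd {H = K} f → e ≡ f
edge-≡ (i , j , i<j , ij) (.i , .j , i<j′ , ij′) refl refl =
  cong₂ (λ lt a → (i , j , lt , a)) (<-irrelevant i<j i<j′) (Decidable⇒UIP.≡-irrelevant Bool._≟_ ij ij′)

module DeleteVertex {m : ℕ} (G : SimpleGraph (suc m)) (v : Fin (suc m)) where

  H : SimpleGraph m
  H = deleteVertex G v

  VG = Fin (suc m) ⊎ Edge G
  VH = Fin m ⊎ Edge H

  lift : Fin m → Fin (suc m)
  lift = punchIn v

  lift-injective : ∀ {x y} → lift x ≡ lift y → x ≡ y
  lift-injective = punchIn-injective v _ _

  liftEdge : Edge H → Edge G
  liftEdge (i , j , i<j , ij) =
    lift i , lift j , ≤∧≢⇒< (punchIn-mono-≤ v i j (<⇒≤ i<j)) (λ eq → <⇒≢ i<j (lift-injective eq)) , ij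

  ι : VH → VG
  ι (inj₁ x) = inj₁ (lift x)
  ι (inj₂ e) = inj₂ (liftEdge e)

  EndG : Fin (suc m) → Edge G → Set
  EndG x e = Endpoint {H = G} x e

  EndH : Fin m → Edge H → Set
  EndH x e = Endpoint {H = H} x e

  lift-endpoint : ∀ {x} e → EndH x e → EndG (lift x) (liftEdge e)
  lift-endpoint e (inj₁ eq) = inj₁ (cong lift eq)
  lift-endpoint e (inj₂ eq) = inj₂ (cong lift eq)

  unlift-endpoint : ∀ {x} e → EndG (lift x) (liftEdge e) → EndH x e
  unlift-endpoint e (inj₁ eq) = inj₁ (lift-injective eq)
  unlift-endpoint e (inj₂ eq) = inj₂ (lift-injective eq)

  endpoint-of-lifted : ∀ x e → EndG x (liftEdge e) → Σ (Fin m) λ w → (x ≡ lift w) × EndH w e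
  endpoint-of-lifted x (i , j , _) (inj₁ eq) = i , eq , inj₁ refl
  endpoint-of-lifted x (i , j , _) (inj₂ eq) = j , eq , inj₂ refl

  v-not-endpoint : ∀ e → ¬ EndG v (liftEdge e)
  v-not-endpoint e v∈e with endpoint-of-lifted v e v∈e
  ... | w , v≡w , _ = punchInᵢ≢i v w (≡-sym v≡w)

  ι-injective : ∀ y z → ι y ≡ ι z → y ≡ z
  ι-injective (inj₁ x) (inj₁ y) eq = cong inj₁ (lift-injective (inj₁-injective eq))
  ι-injective (inj₂ e) (inj₂ f) eq =
    cong inj₂ (edge-≡ {K = H} e f (lift-injective (cong (fst {H = G}) eq′)) (lift-injective (cong (snd {H = G}) eq′)))
    where eq′ = inj₂-injective eq
  ι-injective (inj₁ _) (inj₂ _) ()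
  ι-injective (inj₂ _) (inj₁ _) ()

  ι-preserves : ∀ y z → middleAdj H y z → middleAdj G (ι y) (ι z)
  ι-preserves (inj₁ _) (inj₁ _) ()
  ι-preserves (inj₁ x) (inj₂ f) x∈f = lift-endpoint f x∈f
  ι-preserves (inj₂ e) (inj₁ x) x∈e = lift-endpoint e x∈e
  ι-preserves (inj₂ e) (inj₂ f) (e≢f , x , x∈e , x∈f) =
    (λ eq → e≢f (cong₂ _,_ (lift-injective (cong proj₁ eq)) (lift-injective (cong proj₂ eq))))
    , lift x , lift-endpoint e x∈e , lift-endpoint f x∈f

  ι-reflects : ∀ y z → middleAdj G (ι y) (ι z) → middleAdj H y z
  ι-reflects (inj₁ _) (inj₁ _) ()
  ι-reflects (inj₁ x) (inj₂ f) x∈f = unlift-endpoint f x∈f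
  ι-reflects (inj₂ e) (inj₁ x) x∈e = unlift-endpoint e x∈e
  ι-reflects (inj₂ e) (inj₂ f) (e≢f , x , x∈e , x∈f) with endpoint-of-lifted x e x∈e
  ... | w , refl , w∈e =
    (λ eq → e≢f (cong (λ ij → lift (proj₁ ij) , lift (proj₂ ij)) eq)) , w , w∈e , unlift-endpoint f x∈f

  data Kind (z : VG) : Set where
    is-v      : z ≡ inj₁ v → Kind z
    edge-at-v : (e : Edge G) → z ≡ inj₂ e → EndG v e → Kind z
    image     : (y : VH) → ι y ≡ z → Kind z

  kind : (z : VG) → Kind z
  kind (inj₁ w) with v ≟ w
  ... | yes refl = is-v refl
  ... | no v≢w   = image (inj₁ (punchOut v≢w)) (cong inj₁ (punchIn-punchOut v≢w))
  kind (inj₂ (i , j , i<j , ij)) with v ≟ i | v ≟ j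
  ... | yes v≡i | _       = edge-at-v _ refl (inj₁ v≡i)
  ... | no _    | yes v≡j = edge-at-v _ refl (inj₂ v≡j)
  ... | no v≢i  | no v≢j  =
    image (inj₂ e) (cong inj₂ (edge-≡ {K = G} (liftEdge e) _ (punchIn-punchOut v≢i) (punchIn-punchOut v≢j)))
    where
      i′<j′ : punchOut v≢i <ᶠ punchOut v≢j
      i′<j′ = ≤∧≢⇒< (punchOut-mono-≤ v≢i v≢j (<⇒≤ i<j)) (λ eq → <⇒≢ i<j (punchOut-injective v≢i v≢j eq))
      e : Edge H
      e = punchOut v≢i , punchOut v≢j , i′<j′
        , subst₂ (λ x y → adj G x y ≡ true) (≡-sym (punchIn-punchOut v≢i)) (≡-sym (punchIn-punchOut v≢j)) ij

  covered-by-v : ∀ z → (Σ VH λ y → ι y ≡ z) ⊎ Dominates (Middle G) (inj₁ v) z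
  covered-by-v z with kind z
  ... | is-v refl             = inj₂ (inj₁ refl)
  ... | edge-at-v e refl v∈e  = inj₂ (inj₂ v∈e)
  ... | image y ιy≡z          = inj₁ (y , ιy≡z)

  farEnd : (e : Edge G) → EndG v e → Fin m
  farEnd (i , j , i<j , _) (inj₁ v≡i) = punchOut {i = v} {j = j} (λ v≡j → <⇒≢ i<j (trans (≡-sym v≡i) v≡j))
  farEnd (i , j , i<j , _) (inj₂ v≡j) = punchOut {i = v} {j = i} (λ v≡i → <⇒≢ i<j (trans (≡-sym v≡i) v≡j))

  farEnd-unique : ∀ w e (v∈e : EndG v e) → EndG (lift w) e → w ≡ farEnd e v∈e
  farEnd-unique w (i , j , _) (inj₁ v≡i) (inj₁ w≡i) = ⊥-elim (punchInᵢ≢i v w (trans w≡i (≡-sym v≡i)))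
  farEnd-unique w (i , j , _) (inj₁ v≡i) (inj₂ w≡j) = lift-injective (trans w≡j (≡-sym (punchIn-punchOut _)))
  farEnd-unique w (i , j , _) (inj₂ v≡j) (inj₁ w≡i) = lift-injective (trans w≡i (≡-sym (punchIn-punchOut _)))
  farEnd-unique w (i , j , _) (inj₂ v≡j) (inj₂ w≡j) = ⊥-elim (punchInᵢ≢i v w (trans w≡j (≡-sym v≡j)))

  projectKind : (z : VG) → Kind z → Maybe VH
  projectKind z (is-v _)              = nothing
  projectKind z (edge-at-v e _ v∈e)   = just (inj₁ (farEnd e v∈e))
  projectKind z (image y _)           = just y

  project : VG → Maybe VH
  project z = projectKind z (kind z)

  project-dominates : ∀ d y → Dominates (Middle G) d (ι y)
                    → Σ VH λ z → (project d ≡ just z) × Dominates (Middle H) z y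
  project-dominates d = byKind (kind d)
    where
      byKind : ∀ {d} (k : Kind d) y → Dominates (Middle G) d (ι y)
             → Σ VH λ z → (projectKind d k ≡ just z) × Dominates (Middle H) z y
      -- v dominates nothing in the image of ι.
      byKind (is-v refl) (inj₁ x) (inj₁ eq) = ⊥-elim (punchInᵢ≢i v x (≡-sym (inj₁-injective eq)))
      byKind (is-v refl) (inj₂ f) (inj₂ v∈f) = ⊥-elim (v-not-endpoint f v∈f)
      byKind (is-v refl) (inj₁ x) (inj₂ ())
      byKind (is-v refl) (inj₂ f) (inj₁ ())
      -- An edge vw dominates lifted elements only through the vertex w.
      byKind (edge-at-v e refl v∈e) (inj₁ x) (inj₂ x∈e) =
        _ , refl , inj₁ (cong inj₁ (≡-sym (farEnd-unique x e v∈e x∈e)))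
      byKind (edge-at-v e refl v∈e) (inj₂ f) (inj₁ refl) = ⊥-elim (v-not-endpoint f v∈e)
      byKind (edge-at-v e refl v∈e) (inj₂ f) (inj₂ (_ , x , x∈e , x∈f)) with endpoint-of-lifted x f x∈f
      ... | w , refl , w∈f =
        _ , refl , inj₂ (subst (λ u → EndH u f) (farEnd-unique w e v∈e x∈e) w∈f)
      byKind (edge-at-v e refl v∈e) (inj₁ x) (inj₁ ())
      byKind (image y′ refl) y (inj₁ eq) = y′ , refl , inj₁ (ι-injective y′ y eq)
      byKind (image y′ refl) y (inj₂ adj′) = y′ , refl , inj₂ (ι-reflects y′ y adj′)

lemma2p2 : (m : ℕ) → 2 ≤ suc m → (G : SimpleGraph (suc m)) → (v : Fin (suc m))
    → (a b : ℕ)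
    → IsDominationNumber (Middle G) a
    → IsDominationNumber (Middle (deleteVertex G v)) b
    → (b ≤ a) × (a ≤ b + 1)
lemma2p2 m _ G v a b γG γH = lower , upper
  where
    open DeleteVertex G v

    -- Projecting a dominating set of M(G) does not increase its size.
    lower : b ≤ a
    lower = domination-number-≤ 0 γG γH λ S domS →
      mapMaybe project S
      , dominating-project (Middle G) (Middle H) ι project project-dominates S domS
      , length-mapMaybe project S

    -- Adding v to the image of a dominating set of M(H) costs one element.
    upper : a ≤ b + 1
    upper = subst (a ≤_) (+-comm 1 b) (domination-number-≤ 1 γH γG λ S domS →
      inj₁ v ∷ map ι S
      , dominating-cone (Middle G) (Middle H) ι (inj₁ v) ι-preserves covered-by-v S domS
      , s≤s (≤-reflexive (length-map ι S)))
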